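{- Let $\phi$ denote Euler's totient function. The only nontrivial solutions of the equation $\phi\left(z\frac{x^m-y^m}{x-y}\right)=z\frac{x^n-y^n}{x-y}$ in positive integers $x,y,z,m,n$ with $x>y$ and $\nu_2(x)\neq\nu_2(y)$ are $$(x,y,z,m,n)=(2,1,2^\beta p^u,q,q-1),$$ where $q$ and $p=2^q-1$ are both primes and $\beta,u$ are integers with $\beta\ge1$ and $u\ge 0$.
   Context: For a prime $p$ and positive integer $a$, $\nu_p(a)$ is the exponent $k$ with $p^k\mid a$, $p^{k+1}\nmid a$. A solution $(x,y,z,m,n)$ of this equation in positive integers with $x>y$ is called trivial if it is of the form $(a,b,1,1,1)$ with integers $a>b\ge 1$; all other solutions are nontrivial. No size restriction is imposed on $z$. -}

module Defs where

open import Data.Nat using (ℕ; zero; suc; _+_; _*_; _∸_; _^_)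
open import Data.Nat.DivMod using (_/_)
open import Data.Nat.Divisibility using (_∣_)
open import Data.Nat.Coprimality using (Coprime; coprime?)
open import Data.List using (List; length; filter; map; upTo)
open import Data.Product using (_×_)
open import Relation.Nullary using (¬_)

-- Euler's totient: φ n = #{ k : 1 ≤ k ≤ n , gcd(k,n) = 1 }  (so φ 0 = 0, φ 1 = 1)
φ : ℕ → ℕ
φ n = length (filter (λ k → coprime? k n) (map suc (upTo n)))

_div_ : ℕ → ℕ → ℕ
a div zero = 0
a div suc k = a / suc k

-- (x^m - y^m)/(x - y); an exact quotient whenever x > y.
geomQuot : ℕ → ℕ → ℕ → ℕ
geomQuot x y m = (x ^ m ∸ y ^ m) div (x ∸ y)

HasValuation : ℕ → ℕ → ℕ → Set
HasValuation p a k = (p ^ k ∣ a) × ¬ (p ^ suc k ∣ a)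

-- Write x = 2^c X and y = 2^c Y with X, Y of opposite parity, and z = 2^γ w with w odd. Then
-- (x^k − y^k)/(x − y) = 2^(c(k−1)) H_k with H_k odd, and the equation reads
-- φ (2^(γ + c(m−1)) w H_m) = 2^(γ + c(n−1)) w H_n. Since φ of an odd number ≥ 2 is even, comparing
-- powers of 2 forces c = 0, γ ≥ 1 and φ (w H_m) = 2 w H_n with w H_n odd; so w H_m = p^(e+1) for an
-- odd prime p, and p^e (p − 1) = 2 w H_n. Eliminating w gives 2 p H_n = (p − 1) H_m, hence
-- H_m ≤ 3 H_n, which the growth H_(k+1) ≥ X H_k + 1 allows only for X = 2, Y = 1, m = n + 1;
-- then H_k = 2^k − 1 and p = H_m. Nontrivial solutions have n < m because φ N < N for N ≥ 2.

module Submission where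

open import Defs
open import Data.Nat
open import Data.Nat.Properties
open import Data.Nat.Divisibility
open import Data.Nat.DivMod using (_/_; m*n/n≡m)
open import Data.Nat.Coprimality using (Coprime; coprime?; coprime-+; coprime-divisor)
  renaming (sym to coprime-sym)
open import Data.Nat.Primality
  using (Prime; prime⇒nonTrivial; prime⇒irreducible; irreducible⇒prime; euclidsLemma; prime[2])
open import Data.Nat.Primality.Factorisation using (factorise)
open import Data.Nat.ListAction using (product)
open import Data.Nat.Induction using (<-wellFounded)
open import Data.Nat.Tactic.RingSolver using (solve-∀)
open import Data.List using (_∷_; length; filter; map; applyUpTo)
open import Data.List.Relation.Unary.All using (_∷_)
open import Data.Product using (_×_; _,_; ∃-syntax)
open import Data.Sum using (_⊎_; inj₁; inj₂)
open import Data.Empty using (⊥-elim)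
open import Function using (_∘_)
open import Function.Bundles using (_⇔_; mk⇔)
open import Induction.WellFounded using (Acc; acc)
open import Relation.Nullary using (¬_; Dec; yes; no)
open import Relation.Unary using (Decidable)
open import Relation.Binary using (tri<; tri≈; tri>)
open import Relation.Binary.PropositionalEquality

∑ : ℕ → (ℕ → ℕ) → ℕ
∑ zero    f = 0
∑ (suc n) f = ∑ n f + f n

∑-cong : ∀ n {f g : ℕ → ℕ} → (∀ i → f i ≡ g i) → ∑ n f ≡ ∑ n g
∑-cong zero    f≗g = refl
∑-cong (suc n) f≗g = cong₂ _+_ (∑-cong n f≗g) (f≗g n)

∑-head : ∀ n f → ∑ (suc n) f ≡ f 0 + ∑ n (f ∘ suc)
∑-head zero    f = +-comm 0 (f 0)
∑-head (suc n) f = trans (cong (_+ f (suc n)) (∑-head n f)) (+-assoc (f 0) _ _)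

∑-+ : ∀ a b f → ∑ (a + b) f ≡ ∑ a f + ∑ b (λ i → f (a + i))
∑-+ a zero    f = trans (cong (λ k → ∑ k f) (+-identityʳ a)) (sym (+-identityʳ _))
∑-+ a (suc b) f = trans (cong (λ k → ∑ k f) (+-suc a b))
  (trans (cong (_+ f (a + b)) (∑-+ a b f)) (+-assoc (∑ a f) _ _))

∑-vanishes : ∀ n f → (∀ i → i < n → f i ≡ 0) → ∑ n f ≡ 0
∑-vanishes zero    f f≡0 = refl
∑-vanishes (suc n) f f≡0 = cong₂ _+_ (∑-vanishes n f (λ i i<n → f≡0 i (m<n⇒m<1+n i<n))) (f≡0 n ≤-refl)

∑-distrib-+ : ∀ n f g → ∑ n (λ i → f i + g i) ≡ ∑ n f + ∑ n g
∑-distrib-+ zero    f g = refl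
∑-distrib-+ (suc n) f g = trans (cong (_+ (f n + g n)) (∑-distrib-+ n f g)) (interchange (∑ n f) (∑ n g) (f n) (g n))
  where
  interchange : ∀ a b c d → a + b + (c + d) ≡ a + c + (b + d)
  interchange = solve-∀

∑-periodic : ∀ a M f → (∀ k → f (M + k) ≡ f k) → ∑ (a * M) f ≡ a * ∑ M f
∑-periodic zero    M f periodic = refl
∑-periodic (suc a) M f periodic = trans (∑-+ M (a * M) f)
  (cong (∑ M f +_) (trans (∑-cong (a * M) periodic) (∑-periodic a M f periodic)))

∑-≤ : ∀ n f → (∀ i → f i ≤ 1) → ∑ n f ≤ n
∑-≤ zero    f f≤1 = z≤n
∑-≤ (suc n) f f≤1 = ≤-trans (+-mono-≤ (∑-≤ n f f≤1) (f≤1 n)) (≤-reflexive (+-comm n 1))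

𝟙 : ∀ {P : Set} → Dec P → ℕ
𝟙 (yes _) = 1
𝟙 (no  _) = 0

𝟙≤1 : ∀ {P : Set} (P? : Dec P) → 𝟙 P? ≤ 1
𝟙≤1 (yes _) = s≤s z≤n
𝟙≤1 (no  _) = z≤n

𝟙-cong : ∀ {P Q : Set} → (P → Q) → (Q → P) → (P? : Dec P) (Q? : Dec Q) → 𝟙 P? ≡ 𝟙 Q?
𝟙-cong P⇒Q Q⇒P (yes p) (yes q) = refl
𝟙-cong P⇒Q Q⇒P (yes p) (no ¬q) = ⊥-elim (¬q (P⇒Q p))
𝟙-cong P⇒Q Q⇒P (no ¬p) (yes q) = ⊥-elim (¬p (Q⇒P q))
𝟙-cong P⇒Q Q⇒P (no ¬p) (no ¬q) = refl

length-filter-∷ : ∀ {P : ℕ → Set} (P? : Decidable P) x xs →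
                  length (filter P? (x ∷ xs)) ≡ 𝟙 (P? x) + length (filter P? xs)
length-filter-∷ P? x xs with P? x
... | yes _ = refl
... | no  _ = refl

length-filter≡∑𝟙 : ∀ {P : ℕ → Set} (P? : Decidable P) (g f : ℕ → ℕ) n →
                   length (filter P? (map g (applyUpTo f n))) ≡ ∑ n (λ i → 𝟙 (P? (g (f i))))
length-filter≡∑𝟙 P? g f zero    = refl
length-filter≡∑𝟙 P? g f (suc n) = trans (length-filter-∷ P? (g (f 0)) _)
  (trans (cong (𝟙 (P? (g (f 0))) +_) (length-filter≡∑𝟙 P? g (f ∘ suc) n)) (sym (∑-head n _)))

∑-multiples : ∀ M p (g : ℕ → ℕ) → 1 ≤ p → ∑ (M * p) (λ k → g k * 𝟙 (p ∣? k)) ≡ ∑ M (λ j → g (j * p))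
∑-multiples zero    p         g p≥1 = refl
∑-multiples (suc M) p@(suc q) g p≥1 = begin
    ∑ (p + M * p) h
  ≡⟨ ∑-+ p (M * p) h ⟩
    ∑ p h + ∑ (M * p) (λ i → h (p + i))
  ≡⟨ cong₂ _+_ first-block (∑-cong (M * p) shift) ⟩
    g 0 + ∑ (M * p) (λ i → g (p + i) * 𝟙 (p ∣? i))
  ≡⟨ cong (g 0 +_) (∑-multiples M p (λ k → g (p + k)) p≥1) ⟩
    g 0 + ∑ M (λ j → g (suc j * p))
  ≡⟨ sym (∑-head M (λ j → g (j * p))) ⟩
    ∑ (suc M) (λ j → g (j * p)) ∎
  where
  open ≡-Reasoning
  h : ℕ → ℕ
  h k = g k * 𝟙 (p ∣? k)
  shift : ∀ i → h (p + i) ≡ g (p + i) * 𝟙 (p ∣? i)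
  shift i = cong (g (p + i) *_) (𝟙-cong (λ p∣p+i → ∣m+n∣m⇒∣n p∣p+i ∣-refl) (∣m∣n⇒∣m+n ∣-refl) (p ∣? (p + i)) (p ∣? i))
  inner-vanishes : ∀ i → i < q → h (suc i) ≡ 0
  inner-vanishes i i<q with p ∣? suc i
  ... | yes p∣1+i = ⊥-elim (<⇒≱ (s≤s i<q) (∣⇒≤ p∣1+i))
  ... | no  _     = *-zeroʳ (g (suc i))
  first-block : ∑ p h ≡ g 0
  first-block = begin
      ∑ p h                        ≡⟨ ∑-head q h ⟩
      g 0 * 1 + ∑ q (h ∘ suc)      ≡⟨ cong₂ _+_ (*-identityʳ (g 0)) (∑-vanishes q (h ∘ suc) inner-vanishes) ⟩
      g 0 + 0                      ≡⟨ +-identityʳ (g 0) ⟩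
      g 0 ∎

prime>1 : ∀ {p} → Prime p → 1 < p
prime>1 {p} p-prime = nonTrivial⇒n>1 p {{prime⇒nonTrivial p-prime}}

coprime-*⁻ʳ : ∀ {k m n} → Coprime k (m * n) → Coprime k n
coprime-*⁻ʳ {m = m} k⊥mn (i∣k , i∣n) = k⊥mn (i∣k , ∣n⇒∣m*n m i∣n)

coprime-*⁻ˡ : ∀ {k m n} → Coprime k (m * n) → Coprime k m
coprime-*⁻ˡ {n = n} k⊥mn (i∣k , i∣m) = k⊥mn (i∣k , ∣m⇒∣m*n n i∣m)

coprime-* : ∀ {k m n} → Coprime k m → Coprime k n → Coprime k (m * n)
coprime-* k⊥m k⊥n (i∣k , i∣mn) = k⊥n (i∣k , coprime-divisor (λ (j∣i , j∣m) → k⊥m (∣-trans j∣i i∣k , j∣m)) i∣mn)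

coprime-+⁻ : ∀ {k n} → Coprime (n + k) n → Coprime k n
coprime-+⁻ n+k⊥n (i∣k , i∣n) = n+k⊥n (∣m∣n⇒∣m+n i∣n i∣k , i∣n)

coprime⇒∤ : ∀ {k p} → Prime p → Coprime k p → ¬ p ∣ k
coprime⇒∤ p-prime k⊥p p∣k = <⇒≢ (prime>1 p-prime) (sym (k⊥p (p∣k , ∣-refl)))

∤⇒coprime : ∀ {k p} → Prime p → ¬ p ∣ k → Coprime k p
∤⇒coprime p-prime p∤k (i∣k , i∣p) with prime⇒irreducible p-prime i∣p
... | inj₁ i≡1    = i≡1
... | inj₂ refl   = ⊥-elim (p∤k i∣k)

χ : ℕ → ℕ → ℕ
χ N k = 𝟙 (coprime? k N)

χ-periodic : ∀ N k → χ N (N + k) ≡ χ N k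
χ-periodic N k = 𝟙-cong coprime-+⁻ coprime-+ (coprime? (N + k) N) (coprime? k N)

-- φ counts 1 ≤ k ≤ N, the sum counts 0 ≤ k < N; the two agree because χ N 0 ≡ χ N N.
φ≡∑χ : ∀ N → φ N ≡ ∑ N (χ N)
φ≡∑χ N = trans (length-filter≡∑𝟙 (λ k → coprime? k N) suc (λ k → k) N) (sym (+-cancelʳ-≡ _ _ _ rotate))
  where
  rotate : ∑ N (χ N) + χ N 0 ≡ ∑ N (χ N ∘ suc) + χ N 0
  rotate = begin
      ∑ N (χ N) + χ N 0         ≡⟨ cong (∑ N (χ N) +_) (trans (sym (χ-periodic N 0)) (cong (χ N) (+-identityʳ N))) ⟩
      ∑ (suc N) (χ N)           ≡⟨ ∑-head N (χ N) ⟩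
      χ N 0 + ∑ N (χ N ∘ suc)   ≡⟨ +-comm (χ N 0) _ ⟩
      ∑ N (χ N ∘ suc) + χ N 0   ∎
    where open ≡-Reasoning

φ< : ∀ N → 2 ≤ N → φ N < N
φ< (suc N) (s≤s N≥1) = subst (_< suc N) (sym (φ≡∑χ (suc N))) (s≤s (begin
    ∑ (suc N) (χ (suc N))                  ≡⟨ ∑-head N (χ (suc N)) ⟩
    χ (suc N) 0 + ∑ N (χ (suc N) ∘ suc)   ≤⟨ +-monoˡ-≤ _ χ0≡0 ⟩
    ∑ N (χ (suc N) ∘ suc)                  ≤⟨ ∑-≤ N _ (λ k → 𝟙≤1 (coprime? (suc k) (suc N))) ⟩
    N                                      ∎))
  where
  open ≤-Reasoning
  χ0≡0 : χ (suc N) 0 ≤ 0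
  χ0≡0 with coprime? 0 (suc N)
  ... | no  _   = z≤n
  ... | yes 0⊥n = ⊥-elim (<⇒≢ N≥1 (sym (suc-injective (0⊥n (divides 0 refl , ∣-refl)))))

φ[p*M]≡p*φ[M] : ∀ p M → Prime p → p ∣ M → φ (p * M) ≡ p * φ M
φ[p*M]≡p*φ[M] p M p-prime p∣M = begin
    φ (p * M)              ≡⟨ φ≡∑χ (p * M) ⟩
    ∑ (p * M) (χ (p * M))  ≡⟨ ∑-cong (p * M) χ[p*M]≡χ[M] ⟩
    ∑ (p * M) (χ M)        ≡⟨ ∑-periodic p M (χ M) (χ-periodic M) ⟩
    p * ∑ M (χ M)          ≡⟨ cong (p *_) (sym (φ≡∑χ M)) ⟩
    p * φ M                ∎
  where
  open ≡-Reasoning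
  coprime-*ˡ : ∀ {k} → Coprime k M → Coprime k (p * M)
  coprime-*ˡ k⊥M = coprime-* (∤⇒coprime p-prime (λ p∣k → <⇒≢ (prime>1 p-prime) (sym (k⊥M (p∣k , p∣M))))) k⊥M
  χ[p*M]≡χ[M] : ∀ k → χ (p * M) k ≡ χ M k
  χ[p*M]≡χ[M] k = 𝟙-cong (coprime-*⁻ʳ {m = p}) coprime-*ˡ (coprime? k (p * M)) (coprime? k M)

-- Among 0 ≤ k < p M coprime to M, those with p ∤ k are counted by φ (p M), and the
-- multiples k = j p by φ M, since j p is coprime to M exactly when j is.
φ[p*M]+φ[M]≡p*φ[M] : ∀ p M → Prime p → ¬ p ∣ M → φ (p * M) + φ M ≡ p * φ M
φ[p*M]+φ[M]≡p*φ[M] p M p-prime p∤M = begin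
    φ (p * M) + φ M                          ≡⟨ cong₂ _+_ (φ≡∑χ (p * M)) (trans (φ≡∑χ M) (sym multiples)) ⟩
    ∑ (p * M) (χ (p * M)) + ∑ (p * M) χ∣     ≡⟨ sym (∑-distrib-+ (p * M) (χ (p * M)) χ∣) ⟩
    ∑ (p * M) (λ k → χ (p * M) k + χ∣ k)     ≡⟨ ∑-cong (p * M) split ⟩
    ∑ (p * M) (χ M)                          ≡⟨ ∑-periodic p M (χ M) (χ-periodic M) ⟩
    p * ∑ M (χ M)                            ≡⟨ cong (p *_) (sym (φ≡∑χ M)) ⟩
    p * φ M                                  ∎
  where
  open ≡-Reasoning
  χ∣ : ℕ → ℕ
  χ∣ k = χ M k * 𝟙 (p ∣? k)
  split : ∀ k → χ (p * M) k + χ∣ k ≡ χ M k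
  split k with coprime? k M | coprime? k (p * M) | p ∣? k
  ... | yes k⊥M | yes k⊥pM | yes p∣k = ⊥-elim (coprime⇒∤ p-prime (coprime-*⁻ˡ {n = M} k⊥pM) p∣k)
  ... | yes k⊥M | yes k⊥pM | no  p∤k = refl
  ... | yes k⊥M | no  k⊥̸pM | yes p∣k = refl
  ... | yes k⊥M | no  k⊥̸pM | no  p∤k = ⊥-elim (k⊥̸pM (coprime-* (∤⇒coprime p-prime p∤k) k⊥M))
  ... | no  k⊥̸M | yes k⊥pM | _       = ⊥-elim (k⊥̸M (coprime-*⁻ʳ {m = p} k⊥pM))
  ... | no  k⊥̸M | no  k⊥̸pM | yes p∣k = refl
  ... | no  k⊥̸M | no  k⊥̸pM | no  p∤k = refl
  χ[j*p]≡χ[j] : ∀ j → χ M (j * p) ≡ χ M j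
  χ[j*p]≡χ[j] j = 𝟙-cong jp⊥M⇒j⊥M j⊥M⇒jp⊥M (coprime? (j * p) M) (coprime? j M)
    where
    jp⊥M⇒j⊥M : Coprime (j * p) M → Coprime j M
    jp⊥M⇒j⊥M jp⊥M = coprime-sym (coprime-*⁻ˡ {n = p} (coprime-sym jp⊥M))
    j⊥M⇒jp⊥M : Coprime j M → Coprime (j * p) M
    j⊥M⇒jp⊥M j⊥M = coprime-sym (coprime-* (coprime-sym j⊥M) (∤⇒coprime p-prime p∤M))
  multiples : ∑ (p * M) χ∣ ≡ ∑ M (χ M)
  multiples = begin
    ∑ (p * M) χ∣             ≡⟨ cong (λ n → ∑ n χ∣) (*-comm p M) ⟩
    ∑ (M * p) χ∣             ≡⟨ ∑-multiples M p (χ M) (<⇒≤ (prime>1 p-prime)) ⟩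
    ∑ M (λ j → χ M (j * p))  ≡⟨ ∑-cong M χ[j*p]≡χ[j] ⟩
    ∑ M (χ M)                ∎

φ[p*M]≡[p∸1]*φ[M] : ∀ p M → Prime p → ¬ p ∣ M → φ (p * M) ≡ (p ∸ 1) * φ M
φ[p*M]≡[p∸1]*φ[M] p M p-prime p∤M = begin
    φ (p * M)                   ≡⟨ sym (m+n∸n≡m (φ (p * M)) (φ M)) ⟩
    φ (p * M) + φ M ∸ φ M       ≡⟨ cong (_∸ φ M) (φ[p*M]+φ[M]≡p*φ[M] p M p-prime p∤M) ⟩
    p * φ M ∸ φ M               ≡⟨ cong (p * φ M ∸_) (sym (*-identityˡ (φ M))) ⟩
    p * φ M ∸ 1 * φ M           ≡⟨ sym (*-distribʳ-∸ (φ M) p 1) ⟩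
    (p ∸ 1) * φ M               ∎
  where open ≡-Reasoning

φ[p^[1+e]*R] : ∀ p e R → Prime p → ¬ p ∣ R → φ (p ^ suc e * R) ≡ p ^ e * ((p ∸ 1) * φ R)
φ[p^[1+e]*R] p zero R p-prime p∤R = begin
    φ (p * 1 * R)          ≡⟨ cong (λ k → φ (k * R)) (*-identityʳ p) ⟩
    φ (p * R)              ≡⟨ φ[p*M]≡[p∸1]*φ[M] p R p-prime p∤R ⟩
    (p ∸ 1) * φ R          ≡⟨ sym (*-identityˡ _) ⟩
    1 * ((p ∸ 1) * φ R)    ∎
  where open ≡-Reasoning
φ[p^[1+e]*R] p (suc e) R p-prime p∤R = begin
    φ (p * p ^ suc e * R)             ≡⟨ cong φ (*-assoc p (p ^ suc e) R) ⟩
    φ (p * (p ^ suc e * R))           ≡⟨ φ[p*M]≡p*φ[M] p _ p-prime (∣m⇒∣m*n R (m∣m*n (p ^ e))) ⟩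
    p * φ (p ^ suc e * R)             ≡⟨ cong (p *_) (φ[p^[1+e]*R] p e R p-prime p∤R) ⟩
    p * (p ^ e * ((p ∸ 1) * φ R))     ≡⟨ sym (*-assoc p (p ^ e) _) ⟩
    p * p ^ e * ((p ∸ 1) * φ R)       ∎
  where open ≡-Reasoning

extract-power : ∀ p N → .{{NonTrivial p}} → .{{NonZero N}} → ∃[ e ] ∃[ R ] (N ≡ p ^ e * R × ¬ p ∣ R)
extract-power p N = go N (<-wellFounded N)
  where
  go : ∀ N → .{{NonZero N}} → Acc _<_ N → ∃[ e ] ∃[ R ] (N ≡ p ^ e * R × ¬ p ∣ R)
  go N (acc smaller) with p ∣? N
  ... | no  p∤N = 0 , N , sym (*-identityˡ N) , p∤N
  ... | yes p∣N with go (quotient p∣N) {{quotient≢0 p∣N}} (smaller (quotient-< p∣N))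
  ...   | e , R , q≡p^e*R , p∤R = suc e , R , N≡p^[1+e]*R , p∤R
    where
    N≡p^[1+e]*R : N ≡ p ^ suc e * R
    N≡p^[1+e]*R = begin
      N                      ≡⟨ m∣n⇒n≡m*quotient p∣N ⟩
      p * quotient p∣N       ≡⟨ cong (p *_) q≡p^e*R ⟩
      p * (p ^ e * R)        ≡⟨ sym (*-assoc p (p ^ e) R) ⟩
      p ^ suc e * R          ∎
      where open ≡-Reasoning

∃prime-divisor : ∀ N → 2 ≤ N → ∃[ p ] (Prime p × p ∣ N)
∃prime-divisor (suc zero) (s≤s ())
∃prime-divisor N@(suc (suc _)) _ with factorise N
... | record { factors = p ∷ ps ; isFactorisation = N≡p*ps ; factorsPrime = p-prime ∷ _ } =
  p , p-prime , divides (product ps) (trans N≡p*ps (*-comm p _))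

Odd : ℕ → Set
Odd n = ¬ 2 ∣ n

odd-1 : Odd 1
odd-1 2∣1 with () ← ∣1⇒≡1 2∣1

odd-* : ∀ {m n} → Odd m → Odd n → Odd (m * n)
odd-* {m} {n} odd-m odd-n 2∣mn with euclidsLemma m n prime[2] 2∣mn
... | inj₁ 2∣m = odd-m 2∣m
... | inj₂ 2∣n = odd-n 2∣n

odd-^ : ∀ {m} n → Odd m → Odd (m ^ n)
odd-^ zero    odd-m = odd-1
odd-^ (suc n) odd-m = odd-* odd-m (odd-^ n odd-m)

odd+even : ∀ {m n} → Odd m → 2 ∣ n → Odd (m + n)
odd+even {m} {n} odd-m 2∣n 2∣m+n = odd-m (∣m+n∣m⇒∣n (subst (2 ∣_) (+-comm m n) 2∣m+n) 2∣n)

even+odd : ∀ {m n} → 2 ∣ m → Odd n → Odd (m + n)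
even+odd 2∣m odd-n 2∣m+n = odd-n (∣m+n∣m⇒∣n 2∣m+n 2∣m)

odd⇒nonZero : ∀ {n} → Odd n → NonZero n
odd⇒nonZero {zero}  odd-0 = ⊥-elim (odd-0 (divides 0 refl))
odd⇒nonZero {suc n} _     = _

odd-1+2* : ∀ k → Odd (suc (2 * k))
odd-1+2* k = odd+even odd-1 (m∣m*n k)

odd⇒even-pred : ∀ n → Odd n → 2 ∣ n ∸ 1
odd⇒even-pred zero    odd-0 = ⊥-elim (odd-0 (divides 0 refl))
odd⇒even-pred (suc n) odd-n = odd-suc⇒even n odd-n
  where
  odd-suc⇒even : ∀ n → Odd (suc n) → 2 ∣ n
  odd-suc⇒even zero          _       = divides 0 refl
  odd-suc⇒even (suc zero)    odd-2   = ⊥-elim (odd-2 ∣-refl)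
  odd-suc⇒even (suc (suc n)) odd-n+3 = ∣m∣n⇒∣m+n (∣-refl {2}) (odd-suc⇒even n (odd-n+3 ∘ ∣m∣n⇒∣m+n ∣-refl))

odd⇒prime-power-split : ∀ M → Odd M → 2 ≤ M →
  ∃[ p ] ∃[ e ] ∃[ R ] (Prime p × Odd p × M ≡ p ^ suc e * R × ¬ p ∣ R)
odd⇒prime-power-split M odd-M M≥2 with ∃prime-divisor M M≥2
... | p , p-prime , p∣M with extract-power p M {{prime⇒nonTrivial p-prime}} {{>-nonZero (≤-trans (s≤s z≤n) M≥2)}}
...   | zero  , R , M≡R      , p∤R = ⊥-elim (p∤R (subst (p ∣_) (trans M≡R (*-identityˡ R)) p∣M))
...   | suc e , R , M≡p^e+1R , p∤R = p , e , R , p-prime , odd-M ∘ (λ 2∣p → ∣-trans 2∣p p∣M) , M≡p^e+1R , p∤R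

φ-even : ∀ M → Odd M → 2 ≤ M → 2 ∣ φ M
φ-even M odd-M M≥2 with odd⇒prime-power-split M odd-M M≥2
... | p , e , R , p-prime , odd-p , refl , p∤R =
  subst (2 ∣_) (sym (φ[p^[1+e]*R] p e R p-prime p∤R)) (∣n⇒∣m*n (p ^ e) (∣m⇒∣m*n (φ R) (odd⇒even-pred p odd-p)))

φ≡2*odd⇒prime-power : ∀ M K → Odd M → 2 ≤ M → Odd K → φ M ≡ 2 * K →
  ∃[ p ] ∃[ e ] (Prime p × M ≡ p ^ suc e × φ M ≡ p ^ e * (p ∸ 1))
φ≡2*odd⇒prime-power M K odd-M M≥2 odd-K φM≡2K with odd⇒prime-power-split M odd-M M≥2
... | p , e , zero , p-prime , odd-p , M≡ , p∤0 = ⊥-elim (p∤0 (divides 0 refl))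
... | p , e , 1 , p-prime , odd-p , M≡ , p∤1 =
  p , e , p-prime , trans M≡ (*-identityʳ _) ,
  trans (cong φ M≡) (trans (φ[p^[1+e]*R] p e 1 p-prime p∤1) (cong (p ^ e *_) (*-identityʳ (p ∸ 1))))
... | p , e , R@(suc (suc _)) , p-prime , odd-p , refl , p∤R = ⊥-elim (odd-K (*-cancelˡ-∣ 2 4∣2K))
  where
  odd-R : Odd R
  odd-R 2∣R = odd-M (∣n⇒∣m*n (p ^ suc e) 2∣R)
  4∣2K : 2 * 2 ∣ 2 * K
  4∣2K = subst (2 * 2 ∣_) (trans (sym (φ[p^[1+e]*R] p e R p-prime p∤R)) φM≡2K)
           (∣n⇒∣m*n (p ^ e) (*-pres-∣ (odd⇒even-pred p odd-p) (φ-even R odd-R (s≤s (s≤s z≤n)))))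

[m*n]^k≡m^k*n^k : ∀ m n k → (m * n) ^ k ≡ m ^ k * n ^ k
[m*n]^k≡m^k*n^k m n zero    = refl
[m*n]^k≡m^k*n^k m n (suc k) = trans (cong (m * n *_) ([m*n]^k≡m^k*n^k m n k)) (interchange m n (m ^ k) (n ^ k))
  where
  interchange : ∀ a b c d → a * b * (c * d) ≡ a * c * (b * d)
  interchange = solve-∀

geom : ℕ → ℕ → ℕ → ℕ
geom x y zero    = 0
geom x y (suc k) = x * geom x y k + y ^ k

geom-telescopes : ∀ d y k → d * geom (d + y) y k + y ^ k ≡ (d + y) ^ k
geom-telescopes d y zero    = cong (_+ 1) (*-zeroʳ d)
geom-telescopes d y (suc k) = trans (step d y (geom (d + y) y k) (y ^ k)) (cong ((d + y) *_) (geom-telescopes d y k))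
  where
  step : ∀ d y g t → d * ((d + y) * g + t) + y * t ≡ (d + y) * (d * g + t)
  step = solve-∀

[x∸y]*geom+y^k≡x^k : ∀ {x y} k → y ≤ x → (x ∸ y) * geom x y k + y ^ k ≡ x ^ k
[x∸y]*geom+y^k≡x^k {x} {y} k y≤x =
  subst (λ x′ → (x ∸ y) * geom x′ y k + y ^ k ≡ x′ ^ k) (m∸n+n≡m y≤x) (geom-telescopes (x ∸ y) y k)

geomQuot≡geom : ∀ {x y} k → y < x → geomQuot x y k ≡ geom x y k
geomQuot≡geom {x} {y} k y<x = begin
    (x ^ k ∸ y ^ k) div (x ∸ y)                  ≡⟨ cong (λ a → (a ∸ y ^ k) div (x ∸ y)) (sym ([x∸y]*geom+y^k≡x^k k (<⇒≤ y<x))) ⟩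
    ((x ∸ y) * g + y ^ k ∸ y ^ k) div (x ∸ y)    ≡⟨ cong (_div (x ∸ y)) (m+n∸n≡m _ (y ^ k)) ⟩
    ((x ∸ y) * g) div (x ∸ y)                    ≡⟨ d*q-div-d (m<n⇒0<n∸m y<x) ⟩
    g                                            ∎
  where
  open ≡-Reasoning
  g : ℕ
  g = geom x y k
  d*q-div-d : ∀ {d q} → 0 < d → (d * q) div d ≡ q
  d*q-div-d {suc d} {q} _ = trans (cong (_/ suc d) (*-comm (suc d) q)) (m*n/n≡m q (suc d))

geom-homogeneous : ∀ d X Y k → geom (d * X) (d * Y) (suc k) ≡ d ^ k * geom X Y (suc k)
geom-homogeneous d X Y zero    = trans (cong (_+ 1) (*-zeroʳ (d * X))) (cong (λ t → 1 * (t + 1)) (sym (*-zeroʳ X)))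
geom-homogeneous d X Y (suc k) = begin
    d * X * geom (d * X) (d * Y) (suc k) + (d * Y) ^ suc k  ≡⟨ cong₂ (λ g t → d * X * g + t) (geom-homogeneous d X Y k) ([m*n]^k≡m^k*n^k d Y (suc k)) ⟩
    d * X * (d ^ k * g) + d ^ suc k * Y ^ suc k            ≡⟨ step d X (d ^ k) g (Y ^ suc k) ⟩
    d ^ suc k * (X * g + Y ^ suc k)                        ∎
  where
  open ≡-Reasoning
  g : ℕ
  g = geom X Y (suc k)
  step : ∀ d x e g t → d * x * (e * g) + d * e * t ≡ d * e * (x * g + t)
  step = solve-∀

geom-suc-≥ : ∀ X Y k → 1 ≤ Y → X * geom X Y k + 1 ≤ geom X Y (suc k)
geom-suc-≥ X (suc Y) k _ = +-monoʳ-≤ (X * geom X (suc Y) k) (m^n>0 (suc Y) k)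

geom-positive : ∀ X Y k → 1 ≤ Y → 1 ≤ geom X Y (suc k)
geom-positive X Y k Y≥1 = ≤-trans (m≤n+m 1 _) (geom-suc-≥ X Y k Y≥1)

geom-mono : ∀ X Y {k l} → 1 ≤ X → k ≤ l → geom X Y k ≤ geom X Y l
geom-mono X Y {k} X≥1 k≤l with m≤n⇒∃[o]m+o≡n k≤l
... | o , refl = go o
  where
  go : ∀ o → geom X Y k ≤ geom X Y (k + o)
  go zero    = ≤-reflexive (cong (geom X Y) (sym (+-identityʳ k)))
  go (suc o) = begin
    geom X Y k                             ≤⟨ go o ⟩
    geom X Y (k + o)                       ≤⟨ m≤n*m _ X {{>-nonZero X≥1}} ⟩
    X * geom X Y (k + o)                   ≤⟨ m≤m+n _ _ ⟩
    geom X Y (suc (k + o))                 ≡⟨ cong (geom X Y) (sym (+-suc k o)) ⟩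
    geom X Y (k + suc o)                   ∎
    where open ≤-Reasoning

geom≥2 : ∀ X Y k → 1 ≤ X → 1 ≤ Y → 2 ≤ geom X Y (suc (suc k))
geom≥2 X Y k X≥1 Y≥1 = ≤-trans (+-monoˡ-≤ 1 (*-mono-≤ X≥1 (geom-positive X Y k Y≥1))) (geom-suc-≥ X Y (suc k) Y≥1)

geom≡1⇒k≡1 : ∀ X Y k → 1 ≤ X → 1 ≤ Y → geom X Y k ≡ 1 → k ≡ 1
geom≡1⇒k≡1 X Y zero          X≥1 Y≥1 ()
geom≡1⇒k≡1 X Y (suc zero)    X≥1 Y≥1 _   = refl
geom≡1⇒k≡1 X Y (suc (suc k)) X≥1 Y≥1 g≡1 = ⊥-elim (<⇒≱ (s≤s (s≤s z≤n)) (subst (2 ≤_) g≡1 (geom≥2 X Y k X≥1 Y≥1)))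

geom[2,1]≡2^k∸1 : ∀ k → geom 2 1 k ≡ 2 ^ k ∸ 1
geom[2,1]≡2^k∸1 k = begin
    geom 2 1 k                        ≡⟨ sym (m+n∸n≡m _ 1) ⟩
    geom 2 1 k + 1 ∸ 1                ≡⟨ cong (λ a → a + 1 ∸ 1) (sym (*-identityˡ (geom 2 1 k))) ⟩
    1 * geom 2 1 k + 1 ∸ 1            ≡⟨ cong (λ a → 1 * geom 2 1 k + a ∸ 1) (sym (^-zeroˡ k)) ⟩
    1 * geom 2 1 k + 1 ^ k ∸ 1        ≡⟨ cong (_∸ 1) (geom-telescopes 1 1 k) ⟩
    2 ^ k ∸ 1                         ∎
  where open ≡-Reasoning

geom[2,1]-suc : ∀ k → geom 2 1 (suc k) ≡ suc (2 * geom 2 1 k)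
geom[2,1]-suc k = trans (cong (2 * geom 2 1 k +_) (^-zeroˡ k)) (+-comm _ 1)

OppositeParity : ℕ → ℕ → Set
OppositeParity X Y = (Odd X × 2 ∣ Y) ⊎ (2 ∣ X × Odd Y)

geom-odd : ∀ X Y k → OppositeParity X Y → Odd (geom X Y (suc k))
geom-odd X Y zero    (inj₁ _)            = subst Odd (cong (_+ 1) (sym (*-zeroʳ X))) odd-1
geom-odd X Y (suc k) (inj₁ (odd-X , 2∣Y)) =
  odd+even (odd-* odd-X (geom-odd X Y k (inj₁ (odd-X , 2∣Y)))) (∣m⇒∣m*n _ 2∣Y)
geom-odd X Y k       (inj₂ (2∣X , odd-Y)) = even+odd (∣m⇒∣m*n _ 2∣X) (odd-^ k odd-Y)

2^d∸1∣2^[t*d]∸1 : ∀ d t → 2 ^ d ∸ 1 ∣ 2 ^ (t * d) ∸ 1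
2^d∸1∣2^[t*d]∸1 d t = divides (geom (2 ^ d) 1 t) (begin
    2 ^ (t * d) ∸ 1                                          ≡⟨ cong (λ e → 2 ^ e ∸ 1) (*-comm t d) ⟩
    2 ^ (d * t) ∸ 1                                          ≡⟨ cong (_∸ 1) (sym (^-*-assoc 2 d t)) ⟩
    (2 ^ d) ^ t ∸ 1                                          ≡⟨ cong (_∸ 1) (sym ([x∸y]*geom+y^k≡x^k t (m^n>0 2 d))) ⟩
    (2 ^ d ∸ 1) * geom (2 ^ d) 1 t + 1 ^ t ∸ 1               ≡⟨ cong (λ a → (2 ^ d ∸ 1) * geom (2 ^ d) 1 t + a ∸ 1) (^-zeroˡ t) ⟩
    (2 ^ d ∸ 1) * geom (2 ^ d) 1 t + 1 ∸ 1                   ≡⟨ m+n∸n≡m _ 1 ⟩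
    (2 ^ d ∸ 1) * geom (2 ^ d) 1 t                           ≡⟨ *-comm (2 ^ d ∸ 1) _ ⟩
    geom (2 ^ d) 1 t * (2 ^ d ∸ 1)                           ∎)
  where open ≡-Reasoning

2^a∸1≡2^b∸1⇒a≡b : ∀ {a b} → 2 ^ a ∸ 1 ≡ 2 ^ b ∸ 1 → a ≡ b
2^a∸1≡2^b∸1⇒a≡b {a} {b} eq = ≤-antisym (≮⇒≥ (λ b<a → <⇒≢ (^-monoʳ-< 2 (s≤s (s≤s z≤n)) b<a) (sym 2^a≡2^b)))
                                        (≮⇒≥ (λ a<b → <⇒≢ (^-monoʳ-< 2 (s≤s (s≤s z≤n)) a<b) 2^a≡2^b))
  where
  2^a≡2^b : 2 ^ a ≡ 2 ^ b
  2^a≡2^b = trans (sym (m∸n+n≡m (m^n>0 2 a))) (trans (cong (_+ 1) eq) (m∸n+n≡m (m^n>0 2 b)))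

mersenne-prime⇒prime-exponent : ∀ m → Prime (2 ^ m ∸ 1) → Prime m
mersenne-prime⇒prime-exponent zero          P-prime with () ← prime>1 P-prime
mersenne-prime⇒prime-exponent (suc zero)    P-prime with s≤s () ← prime>1 P-prime
mersenne-prime⇒prime-exponent m@(suc (suc _)) P-prime = irreducible⇒prime irreducible
  where
  irreducible : ∀ {d} → d ∣ m → d ≡ 1 ⊎ d ≡ m
  irreducible {d} (divides t m≡t*d) with prime⇒irreducible P-prime
    (subst (λ k → 2 ^ d ∸ 1 ∣ 2 ^ k ∸ 1) (sym m≡t*d) (2^d∸1∣2^[t*d]∸1 d t))
  ... | inj₁ 2^d∸1≡1 = inj₁ (2^a∸1≡2^b∸1⇒a≡b 2^d∸1≡1)
  ... | inj₂ 2^d∸1≡P = inj₂ (2^a∸1≡2^b∸1⇒a≡b 2^d∸1≡P)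

n≤φ[n]⇒n≤1 : ∀ N → N ≤ φ N → N ≤ 1
n≤φ[n]⇒n≤1 N N≤φN with 2 ≤? N
... | yes N≥2 = ⊥-elim (<⇒≱ (φ< N N≥2) N≤φN)
... | no  N≱2 = ≤-pred (≰⇒> N≱2)

solution⇒n<m : ∀ x y z m n → 1 ≤ x → 1 ≤ y → 1 ≤ z → 1 ≤ m →
  φ (z * geom x y m) ≡ z * geom x y n → ¬ (z ≡ 1 × m ≡ 1 × n ≡ 1) → n < m
solution⇒n<m x y z zero    n x≥1 y≥1 z≥1 () eq nontrivial
solution⇒n<m x y z (suc m) n x≥1 y≥1 z≥1 m≥1 eq nontrivial with n <? suc m
... | yes n<m = n<m
... | no  n≮m = ⊥-elim (nontrivial (m*n≡1⇒m≡1 z _ N≡1 ,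
                                    geom≡1⇒k≡1 x y (suc m) x≥1 y≥1 (m*n≡1⇒n≡1 z _ N≡1) ,
                                    geom≡1⇒k≡1 x y n x≥1 y≥1 (m*n≡1⇒n≡1 z _ (trans (sym eq) (cong φ N≡1)))))
  where
  N : ℕ
  N = z * geom x y (suc m)
  N≤φN : N ≤ φ N
  N≤φN = ≤-trans (*-monoʳ-≤ z (geom-mono x y x≥1 (≮⇒≥ n≮m))) (≤-reflexive (sym eq))
  N≥1 : 1 ≤ N
  N≥1 = *-mono-≤ z≥1 (geom-positive x y m y≥1)
  N≡1 : N ≡ 1
  N≡1 = ≤-antisym (n≤φ[n]⇒n≤1 N N≤φN) N≥1

2^k*odd-valuation : ∀ {N} k {X} → N ≡ 2 ^ k * X → Odd X → HasValuation 2 N k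
2^k*odd-valuation {N} k {X} N≡2^kX odd-X =
  divides X (trans N≡2^kX (*-comm _ X)) ,
  λ 2^[1+k]∣N → odd-X (*-cancelˡ-∣ (2 ^ k) {{m^n≢0 2 k}} (subst₂ _∣_ (*-comm 2 (2 ^ k)) N≡2^kX 2^[1+k]∣N))

2^b*W≡2^a*even : ∀ {a b} W → a < b → ∃[ W′ ] (2 ^ b * W ≡ 2 ^ a * W′ × 2 ∣ W′)
2^b*W≡2^a*even {a} W a<b with m≤n⇒∃[o]m+o≡n a<b
... | o , refl = 2 ^ suc o * W , 2^[1+a+o]*W≡2^a*[2^[1+o]*W] , ∣m⇒∣m*n W (m∣m*n (2 ^ o))
  where
  2^[1+a+o]*W≡2^a*[2^[1+o]*W] : 2 ^ (suc a + o) * W ≡ 2 ^ a * (2 ^ suc o * W)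
  2^[1+a+o]*W≡2^a*[2^[1+o]*W] = begin
    2 ^ (suc a + o) * W        ≡⟨ cong (λ e → 2 ^ e * W) (sym (+-suc a o)) ⟩
    2 ^ (a + suc o) * W        ≡⟨ cong (_* W) (^-distribˡ-+-* 2 a (suc o)) ⟩
    2 ^ a * 2 ^ suc o * W      ≡⟨ *-assoc (2 ^ a) _ W ⟩
    2 ^ a * (2 ^ suc o * W)    ∎
    where open ≡-Reasoning

common-power-of-two : ∀ x y → 1 ≤ x → 1 ≤ y →
  (∀ k l → HasValuation 2 x k → HasValuation 2 y l → k ≢ l) →
  ∃[ c ] ∃[ X ] ∃[ Y ] (x ≡ 2 ^ c * X × y ≡ 2 ^ c * Y × OppositeParity X Y)
common-power-of-two x y x≥1 y≥1 distinct
  with extract-power 2 x {{_}} {{>-nonZero x≥1}} | extract-power 2 y {{_}} {{>-nonZero y≥1}}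
... | a , X , x≡2^aX , odd-X | b , Y , y≡2^bY , odd-Y with <-cmp a b
... | tri≈ _ a≡b _ = ⊥-elim (distinct a b (2^k*odd-valuation a x≡2^aX odd-X) (2^k*odd-valuation b y≡2^bY odd-Y) a≡b)
... | tri< a<b _ _ = let Y′ , 2^bY≡2^aY′ , 2∣Y′ = 2^b*W≡2^a*even Y a<b in
  a , X , Y′ , x≡2^aX , trans y≡2^bY 2^bY≡2^aY′ , inj₁ (odd-X , 2∣Y′)
... | tri> _ _ b<a = let X′ , 2^aX≡2^bX′ , 2∣X′ = 2^b*W≡2^a*even X b<a in
  b , X′ , Y , trans x≡2^aX 2^aX≡2^bX′ , y≡2^bY , inj₂ (2∣X′ , odd-Y)

2^i*u≡2^j*v⇒2∣v : ∀ {i j} u v → j < i → 2 ^ i * u ≡ 2 ^ j * v → 2 ∣ v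
2^i*u≡2^j*v⇒2∣v {j = j} u v j<i eq with 2^b*W≡2^a*even u j<i
... | u′ , 2^iu≡2^ju′ , 2∣u′ = subst (2 ∣_) (*-cancelˡ-≡ u′ v (2 ^ j) {{m^n≢0 2 j}} (trans (sym 2^iu≡2^ju′) eq)) 2∣u′

φ[2^β*M]≡2^α*K⇒ : ∀ α β M K → Odd M → 2 ≤ M → Odd K → α ≤ β →
  φ (2 ^ β * M) ≡ 2 ^ α * K → α ≡ β × 1 ≤ β × φ M ≡ 2 * K
φ[2^β*M]≡2^α*K⇒ .zero zero M K odd-M M≥2 odd-K z≤n eq =
  ⊥-elim (odd-K (subst (2 ∣_) (trans (cong φ (sym (*-identityˡ M))) (trans eq (*-identityˡ K))) (φ-even M odd-M M≥2)))
φ[2^β*M]≡2^α*K⇒ α (suc b) M K odd-M M≥2 odd-K α≤β eq with φ-even M odd-M M≥2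
... | divides j φM≡j*2 = conclude (m≤n⇒m<n∨m≡n α≤β)
  where
  2^[1+b]*j≡2^α*K : 2 ^ suc b * j ≡ 2 ^ α * K
  2^[1+b]*j≡2^α*K = begin
    2 ^ suc b * j           ≡⟨ regroup (2 ^ b) j ⟩
    2 ^ b * (1 * (j * 2))   ≡⟨ cong (λ t → 2 ^ b * (1 * t)) (sym φM≡j*2) ⟩
    2 ^ b * (1 * φ M)       ≡⟨ sym (φ[p^[1+e]*R] 2 b M prime[2] odd-M) ⟩
    φ (2 ^ suc b * M)       ≡⟨ eq ⟩
    2 ^ α * K               ∎
    where
    open ≡-Reasoning
    regroup : ∀ t j → 2 * t * j ≡ t * (1 * (j * 2))
    regroup = solve-∀
  conclude : α < suc b ⊎ α ≡ suc b → α ≡ suc b × 1 ≤ suc b × φ M ≡ 2 * K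
  conclude (inj₁ α<β) = ⊥-elim (odd-K (2^i*u≡2^j*v⇒2∣v j K α<β 2^[1+b]*j≡2^α*K))
  conclude (inj₂ α≡β) = α≡β , s≤s z≤n , trans φM≡j*2 (trans (*-comm j 2) (cong (2 *_) j≡K))
    where
    j≡K : j ≡ K
    j≡K = *-cancelˡ-≡ j K (2 ^ suc b) {{m^n≢0 2 (suc b)}}
            (trans 2^[1+b]*j≡2^α*K (cong (λ e → 2 ^ e * K) α≡β))

φ[2^[γ+c*m]*M]≡2^[γ+c*n]*K⇒c≡0 : ∀ c γ m n M K → n < m → Odd M → 2 ≤ M → Odd K →
  φ (2 ^ (γ + c * m) * M) ≡ 2 ^ (γ + c * n) * K → c ≡ 0 × 1 ≤ γ × φ M ≡ 2 * K
φ[2^[γ+c*m]*M]≡2^[γ+c*n]*K⇒c≡0 c γ m n M K n<m odd-M M≥2 odd-K eq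
  with φ[2^β*M]≡2^α*K⇒ (γ + c * n) (γ + c * m) M K odd-M M≥2 odd-K (+-monoʳ-≤ γ (*-monoʳ-≤ c (<⇒≤ n<m))) eq
φ[2^[γ+c*m]*M]≡2^[γ+c*n]*K⇒c≡0 zero    γ m n M K n<m _ _ _ _ | _ , β≥1 , φM≡2K =
  refl , subst (1 ≤_) (+-identityʳ γ) β≥1 , φM≡2K
φ[2^[γ+c*m]*M]≡2^[γ+c*n]*K⇒c≡0 (suc c) γ m n M K n<m _ _ _ _ | α≡β , _ , _ =
  ⊥-elim (<⇒≢ n<m (*-cancelˡ-≡ n m (suc c) (+-cancelˡ-≡ γ _ _ α≡β)))

z*h≡p^[1+e]⇒2*p*h′≡[p∸1]*h : ∀ z p e h h′ → 1 ≤ z → z * h ≡ p ^ suc e → p ^ e * (p ∸ 1) ≡ 2 * (z * h′) →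
  2 * p * h′ ≡ (p ∸ 1) * h
z*h≡p^[1+e]⇒2*p*h′≡[p∸1]*h z p e h h′ z≥1 zh≡p^[1+e] φ≡2zh′ = *-cancelˡ-≡ _ _ z {{>-nonZero z≥1}} (begin
    z * (2 * p * h′)         ≡⟨ regroup₁ z p h′ ⟩
    p * (2 * (z * h′))       ≡⟨ cong (p *_) (sym φ≡2zh′) ⟩
    p * (p ^ e * (p ∸ 1))    ≡⟨ sym (*-assoc p (p ^ e) (p ∸ 1)) ⟩
    p ^ suc e * (p ∸ 1)      ≡⟨ cong (_* (p ∸ 1)) (sym zh≡p^[1+e]) ⟩
    z * h * (p ∸ 1)          ≡⟨ regroup₂ z h (p ∸ 1) ⟩
    z * ((p ∸ 1) * h)        ∎)
  where
  open ≡-Reasoning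
  regroup₁ : ∀ z p h → z * (2 * p * h) ≡ p * (2 * (z * h))
  regroup₁ = solve-∀
  regroup₂ : ∀ z h q → z * h * q ≡ z * (q * h)
  regroup₂ = solve-∀

2*p*h≡[p∸1]*h′⇒h′≤3*h : ∀ p h h′ → 3 ≤ p → 2 * p * h ≡ (p ∸ 1) * h′ → h′ ≤ 3 * h
2*p*h≡[p∸1]*h′⇒h′≤3*h (suc a) h h′ (s≤s a≥2) eq = *-cancelˡ-≤ a {{>-nonZero (≤-trans (s≤s z≤n) a≥2)}} (begin
    a * h′                   ≡⟨ sym eq ⟩
    2 * suc a * h            ≡⟨ expand a h ⟩
    2 * a * h + 2 * h        ≤⟨ +-monoʳ-≤ (2 * a * h) (*-monoˡ-≤ h a≥2) ⟩
    2 * a * h + a * h        ≡⟨ collect a h ⟩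
    a * (3 * h)              ∎)
  where
  open ≤-Reasoning
  expand : ∀ a h → 2 * suc a * h ≡ 2 * a * h + 2 * h
  expand = solve-∀
  collect : ∀ a h → 2 * a * h + a * h ≡ a * (3 * h)
  collect = solve-∀

2*p*h≡[p∸1]*[1+2*h]⇒p≡1+2*h : ∀ p h → 1 ≤ p → 2 * p * h ≡ (p ∸ 1) * suc (2 * h) → p ≡ suc (2 * h)
2*p*h≡[p∸1]*[1+2*h]⇒p≡1+2*h (suc a) h _ eq = cong suc (sym (+-cancelʳ-≡ (2 * a * h) (2 * h) a (begin
    2 * h + 2 * a * h        ≡⟨ expand a h ⟩
    2 * suc a * h            ≡⟨ eq ⟩
    a * suc (2 * h)          ≡⟨ expand′ a h ⟩
    a + 2 * a * h            ∎)))
  where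
  open ≡-Reasoning
  expand : ∀ a h → 2 * h + 2 * a * h ≡ 2 * suc a * h
  expand = solve-∀
  expand′ : ∀ a h → a * suc (2 * h) ≡ a + 2 * a * h
  expand′ = solve-∀

1≤Y<X≤2⇒ : ∀ {X Y} → 1 ≤ Y → Y < X → X ≤ 2 → X ≡ 2 × Y ≡ 1
1≤Y<X≤2⇒ {2} {1} _ _ _ = refl , refl
1≤Y<X≤2⇒ {2} {suc (suc _)} _ (s≤s (s≤s ())) _
1≤Y<X≤2⇒ {1} {suc _} _ (s≤s ()) _
1≤Y<X≤2⇒ {suc (suc (suc _))} _ _ (s≤s (s≤s ()))

geom≤3*geom⇒ : ∀ X Y m n → 1 ≤ Y → Y < X → n < m → geom X Y m ≤ 3 * geom X Y n → X ≡ 2 × Y ≡ 1 × m ≡ suc n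
geom≤3*geom⇒ X Y m n Y≥1 Y<X n<m ≤3h with X ≤? 2
... | no X≰2 = ⊥-elim (<⇒≱ (begin-strict
    3 * h                     <⟨ m<m+n (3 * h) (s≤s z≤n) ⟩
    3 * h + 1                 ≤⟨ +-monoˡ-≤ 1 (*-monoˡ-≤ h (≰⇒> X≰2)) ⟩
    X * h + 1                 ≤⟨ geom-suc-≥ X Y n Y≥1 ⟩
    geom X Y (suc n)          ≤⟨ geom-mono X Y (≤-trans (s≤s z≤n) Y<X) n<m ⟩
    geom X Y m                ∎) ≤3h)
  where
  open ≤-Reasoning
  h : ℕ
  h = geom X Y n
... | yes X≤2 with 1≤Y<X≤2⇒ Y≥1 Y<X X≤2
...   | refl , refl with m ≟ suc n
...     | yes m≡1+n = refl , refl , m≡1+n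
...     | no  m≢1+n = ⊥-elim (<⇒≱ (begin-strict
    3 * h                     <⟨ 3h<4h+3 h ⟩
    2 * (2 * h + 1) + 1       ≤⟨ +-monoˡ-≤ 1 (*-monoʳ-≤ 2 (geom-suc-≥ 2 1 n (s≤s z≤n))) ⟩
    2 * geom 2 1 (suc n) + 1  ≤⟨ geom-suc-≥ 2 1 (suc n) (s≤s z≤n) ⟩
    geom 2 1 (suc (suc n))    ≤⟨ geom-mono 2 1 (s≤s z≤n) (≤∧≢⇒< n<m (m≢1+n ∘ sym)) ⟩
    geom 2 1 m                ∎) ≤3h)
  where
  open ≤-Reasoning
  h : ℕ
  h = geom 2 1 n
  3h<4h+3 : ∀ h → 3 * h < 2 * (2 * h + 1) + 1
  3h<4h+3 h = subst (3 * h <_) (shape h) (m<m+n (3 * h) (s≤s (z≤n {h + 2})))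
    where
    shape : ∀ h → 3 * h + suc (h + 2) ≡ 2 * (2 * h + 1) + 1
    shape = solve-∀

odd-prime⇒≥3 : ∀ {p} → Prime p → Odd p → 3 ≤ p
odd-prime⇒≥3 {0}               p-prime _     with () ← prime>1 p-prime
odd-prime⇒≥3 {1}               p-prime _     with s≤s () ← prime>1 p-prime
odd-prime⇒≥3 {2}               _       odd-2 = ⊥-elim (odd-2 ∣-refl)
odd-prime⇒≥3 {suc (suc (suc _))} _     _     = s≤s (s≤s (s≤s z≤n))

odd-solution⇒prime-power : ∀ w h h′ → Odd w → Odd h → Odd h′ → 2 ≤ h → φ (w * h) ≡ 2 * (w * h′) →
  ∃[ p ] ∃[ e ] (Prime p × 3 ≤ p × w * h ≡ p ^ suc e × 2 * p * h′ ≡ (p ∸ 1) * h)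
odd-solution⇒prime-power zero    h h′ odd-w _ _ _ _ = ⊥-elim (odd-w (divides 0 refl))
odd-solution⇒prime-power w@(suc _) h h′ odd-w odd-h odd-h′ h≥2 eq
  with φ≡2*odd⇒prime-power (w * h) (w * h′) (odd-* odd-w odd-h) (*-mono-≤ {1} {w} (s≤s z≤n) h≥2) (odd-* odd-w odd-h′) eq
... | p , e , p-prime , wh≡p^[1+e] , φ[wh]≡ =
  p , e , p-prime , odd-prime⇒≥3 p-prime odd-p , wh≡p^[1+e] ,
  z*h≡p^[1+e]⇒2*p*h′≡[p∸1]*h w p e h h′ (s≤s z≤n) wh≡p^[1+e] (trans (sym φ[wh]≡) eq)
  where
  odd-p : Odd p
  odd-p 2∣p = odd-* odd-w odd-h (subst (2 ∣_) (sym wh≡p^[1+e]) (∣m⇒∣m*n (p ^ e) 2∣p))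

odd-solution⇒mersenne : ∀ X Y m n w → 1 ≤ Y → Y < X → n < m → OppositeParity X Y → Odd w →
  φ (w * geom X Y (suc m)) ≡ 2 * (w * geom X Y (suc n)) →
  X ≡ 2 × Y ≡ 1 × m ≡ suc n × Prime (2 ^ suc m ∸ 1) × ∃[ e ] (w ≡ (2 ^ suc m ∸ 1) ^ e)
odd-solution⇒mersenne X Y (suc m) n w Y≥1 Y<X n<m parity odd-w eq
  with odd-solution⇒prime-power w (geom X Y (suc (suc m))) (geom X Y (suc n)) odd-w
         (geom-odd X Y (suc m) parity) (geom-odd X Y n parity) (geom≥2 X Y m (≤-trans Y≥1 (<⇒≤ Y<X)) Y≥1) eq
... | p , e , p-prime , p≥3 , wh≡p^[1+e] , key
  with geom≤3*geom⇒ X Y (suc (suc m)) (suc n) Y≥1 Y<X (s≤s n<m) (2*p*h≡[p∸1]*h′⇒h′≤3*h p _ _ p≥3 key)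
... | refl , refl , refl = refl , refl , refl , subst Prime p≡P p-prime , e , w≡P^e
  where
  h : ℕ
  h = geom 2 1 (suc n)
  p≡1+2h : p ≡ suc (2 * h)
  p≡1+2h = 2*p*h≡[p∸1]*[1+2*h]⇒p≡1+2*h p h (≤-trans (s≤s z≤n) p≥3) (trans key (cong ((p ∸ 1) *_) (geom[2,1]-suc (suc n))))
  p≡geom : p ≡ geom 2 1 (suc (suc n))
  p≡geom = trans p≡1+2h (sym (geom[2,1]-suc (suc n)))
  p≡P : p ≡ 2 ^ suc (suc n) ∸ 1
  p≡P = trans p≡geom (geom[2,1]≡2^k∸1 (suc (suc n)))
  w≡p^e : w ≡ p ^ e
  w≡p^e = *-cancelʳ-≡ w (p ^ e) p {{>-nonZero (≤-trans (s≤s z≤n) p≥3)}}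
    (trans (cong (w *_) p≡geom) (trans wh≡p^[1+e] (*-comm p (p ^ e))))
  w≡P^e : w ≡ (2 ^ suc (suc n) ∸ 1) ^ e
  w≡P^e = trans w≡p^e (cong (_^ e) p≡P)

2^γ*w*geom[2^c*X,2^c*Y] : ∀ γ w c X Y k →
  2 ^ γ * w * geom (2 ^ c * X) (2 ^ c * Y) (suc k) ≡ 2 ^ (γ + c * k) * (w * geom X Y (suc k))
2^γ*w*geom[2^c*X,2^c*Y] γ w c X Y k = begin
    2 ^ γ * w * geom (2 ^ c * X) (2 ^ c * Y) (suc k)   ≡⟨ cong (2 ^ γ * w *_) (geom-homogeneous (2 ^ c) X Y k) ⟩
    2 ^ γ * w * ((2 ^ c) ^ k * g)                      ≡⟨ cong (λ t → 2 ^ γ * w * (t * g)) (^-*-assoc 2 c k) ⟩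
    2 ^ γ * w * (2 ^ (c * k) * g)                      ≡⟨ regroup (2 ^ γ) w (2 ^ (c * k)) g ⟩
    2 ^ γ * 2 ^ (c * k) * (w * g)                      ≡⟨ cong (_* (w * g)) (sym (^-distribˡ-+-* 2 γ (c * k))) ⟩
    2 ^ (γ + c * k) * (w * g)                          ∎
  where
  open ≡-Reasoning
  g : ℕ
  g = geom X Y (suc k)
  regroup : ∀ a w b g → a * w * (b * g) ≡ a * b * (w * g)
  regroup = solve-∀

reduced-solution⇒mersenne : ∀ c X Y γ w m n → 1 ≤ Y → Y < X → n < m → OppositeParity X Y → Odd w →
  φ (2 ^ (γ + c * m) * (w * geom X Y (suc m))) ≡ 2 ^ (γ + c * n) * (w * geom X Y (suc n)) →
  c ≡ 0 × 1 ≤ γ × X ≡ 2 × Y ≡ 1 × m ≡ suc n × Prime (2 ^ suc m ∸ 1) × ∃[ e ] (w ≡ (2 ^ suc m ∸ 1) ^ e)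
reduced-solution⇒mersenne c X Y γ w m n Y≥1 Y<X n<m parity odd-w eq =
  let c≡0 , γ≥1 , φ[wHm]≡2wHn = φ[2^[γ+c*m]*M]≡2^[γ+c*n]*K⇒c≡0 c γ m n (w * Hm) (w * Hn) n<m odd-wHm wHm≥2 odd-wHn eq
  in c≡0 , γ≥1 , odd-solution⇒mersenne X Y m n w Y≥1 Y<X n<m parity odd-w φ[wHm]≡2wHn
  where
  Hm Hn : ℕ
  Hm = geom X Y (suc m)
  Hn = geom X Y (suc n)
  odd-wHm : Odd (w * Hm)
  odd-wHm = odd-* odd-w (geom-odd X Y m parity)
  odd-wHn : Odd (w * Hn)
  odd-wHn = odd-* odd-w (geom-odd X Y n parity)
  wHm≥2 : 2 ≤ w * Hm
  wHm≥2 = ≤-trans (≤-trans (geom≥2 X Y n X≥1 Y≥1) (geom-mono X Y X≥1 (s≤s n<m))) (m≤n*m Hm w {{odd⇒nonZero odd-w}})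
    where
    X≥1 : 1 ≤ X
    X≥1 = ≤-trans Y≥1 (<⇒≤ Y<X)

MersenneSolution : ℕ → ℕ → ℕ → ℕ → ℕ → Set
MersenneSolution x y z m n = ∃[ q ] ∃[ β ] ∃[ u ] (Prime q × Prime (2 ^ q ∸ 1) × 1 ≤ β ×
  x ≡ 2 × y ≡ 1 × z ≡ 2 ^ β * (2 ^ q ∸ 1) ^ u × m ≡ q × n ≡ q ∸ 1)

solution⇒mersenne : ∀ x y z m n → 1 ≤ x → 1 ≤ y → 1 ≤ z → 1 ≤ n → n < m → y < x →
  (∀ k l → HasValuation 2 x k → HasValuation 2 y l → k ≢ l) →
  φ (z * geom x y m) ≡ z * geom x y n → MersenneSolution x y z m n
solution⇒mersenne x y z (suc m) (suc n) x≥1 y≥1 z≥1 _ (s≤s n<m) y<x distinct eq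
  with common-power-of-two x y x≥1 y≥1 distinct | extract-power 2 z {{_}} {{>-nonZero z≥1}}
... | c , X , Y , refl , refl , parity | γ , w , refl , odd-w
  with reduced-solution⇒mersenne c X Y γ w m n Y≥1 (*-cancelˡ-< (2 ^ c) Y X y<x) n<m parity odd-w
         (trans (cong φ (sym (2^γ*w*geom[2^c*X,2^c*Y] γ w c X Y m))) (trans eq (2^γ*w*geom[2^c*X,2^c*Y] γ w c X Y n)))
  where
  Y≥1 : 1 ≤ Y
  Y≥1 = >-nonZero⁻¹ Y {{m*n≢0⇒n≢0 (2 ^ c) {{>-nonZero y≥1}}}}
... | refl , γ≥1 , refl , refl , refl , P-prime , e , refl =
  suc m , γ , e , mersenne-prime⇒prime-exponent (suc m) P-prime , P-prime , γ≥1 , refl , refl , refl , refl , refl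

φ[2^[1+b]*P^u*P] : ∀ b u g → Prime (suc (2 * g)) →
  φ (2 ^ suc b * suc (2 * g) ^ u * suc (2 * g)) ≡ 2 ^ suc b * suc (2 * g) ^ u * g
φ[2^[1+b]*P^u*P] b u g P-prime = begin
    φ (2 ^ suc b * P ^ u * P)                  ≡⟨ cong φ (regroup₁ (2 ^ suc b) (P ^ u) P) ⟩
    φ (2 ^ suc b * (P ^ suc u * 1))            ≡⟨ φ[p^[1+e]*R] 2 b (P ^ suc u * 1) prime[2] (odd-* (odd-^ (suc u) (odd-1+2* g)) odd-1) ⟩
    2 ^ b * (1 * φ (P ^ suc u * 1))            ≡⟨ cong (λ t → 2 ^ b * (1 * t)) (φ[p^[1+e]*R] P u 1 P-prime P∤1) ⟩
    2 ^ b * (1 * (P ^ u * (2 * g * φ 1)))      ≡⟨ regroup₂ (2 ^ b) (P ^ u) g ⟩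
    2 ^ suc b * P ^ u * g                      ∎
  where
  open ≡-Reasoning
  P : ℕ
  P = suc (2 * g)
  P∤1 : ¬ P ∣ 1
  P∤1 P∣1 = <⇒≢ (prime>1 P-prime) (sym (∣1⇒≡1 P∣1))
  regroup₁ : ∀ a q p → a * q * p ≡ a * (p * q * 1)
  regroup₁ = solve-∀
  regroup₂ : ∀ a q g → a * (1 * (q * (2 * g * 1))) ≡ 2 * a * q * g
  regroup₂ = solve-∀

mersenne⇒solution : ∀ x y z m n → MersenneSolution x y z m n →
  φ (z * geom x y m) ≡ z * geom x y n × ¬ (z ≡ 1 × m ≡ 1 × n ≡ 1)
mersenne⇒solution x y z m n (zero , _ , _ , q-prime , _) with () ← prime>1 q-prime
mersenne⇒solution x y z m n (suc q , suc b , u , _ , P-prime , _ , refl , refl , refl , refl , refl) =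
  subst₂ (λ P G → φ (2 ^ suc b * P ^ u * G) ≡ 2 ^ suc b * P ^ u * geom 2 1 q) (sym P≡1+2g) (sym (geom[2,1]-suc q))
    (φ[2^[1+b]*P^u*P] b u g (subst Prime P≡1+2g P-prime)) ,
  λ (z≡1 , _) → 2≢1 (m*n≡1⇒m≡1 2 (2 ^ b) (m*n≡1⇒m≡1 (2 ^ suc b) _ z≡1))
  where
  g : ℕ
  g = geom 2 1 q
  P≡1+2g : 2 ^ suc q ∸ 1 ≡ suc (2 * g)
  P≡1+2g = trans (sym (geom[2,1]≡2^k∸1 (suc q))) (geom[2,1]-suc q)
  2≢1 : 2 ≢ 1
  2≢1 ()

theorem5 : (x y z m n : ℕ) → 1 ≤ x → 1 ≤ y → 1 ≤ z → 1 ≤ m → 1 ≤ n → y < x →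
             (∀ k l → HasValuation 2 x k → HasValuation 2 y l → k ≢ l) →
             ((φ (z * geomQuot x y m) ≡ z * geomQuot x y n × ¬ (z ≡ 1 × m ≡ 1 × n ≡ 1))
              ⇔ (∃[ q ] ∃[ β ] ∃[ u ] (Prime q × Prime (2 ^ q ∸ 1) × 1 ≤ β ×
                  x ≡ 2 × y ≡ 1 × z ≡ 2 ^ β * (2 ^ q ∸ 1) ^ u × m ≡ q × n ≡ q ∸ 1)))
theorem5 x y z m n x≥1 y≥1 z≥1 m≥1 n≥1 y<x distinct
  rewrite geomQuot≡geom m y<x | geomQuot≡geom n y<x = mk⇔
    (λ (eq , nontrivial) → solution⇒mersenne x y z m n x≥1 y≥1 z≥1 n≥1
                             (solution⇒n<m x y z m n x≥1 y≥1 z≥1 m≥1 eq nontrivial) y<x distinct eq)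
    (mersenne⇒solution x y z m n)
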